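{- Let $h,w\ge 4$ and let $G=C_w(U)\sqcap C_h$ with $U=\{i,i+1,i+2\}$ for some $i$ with $1\le i\le w-2$. Then $Z(G)\le h+2$.
   Context: All graphs are finite, simple and undirected. The cycle $C_n$ ($n\ge3$) has vertex set $\{1,\dots,n\}$ and edges $\{k,k+1\}$ for $1\le k\le n-1$ together with $\{n,1\}$. For graphs $W,H$ and a subset $U\subseteq V(W)$ (the root set), the (generalized) hierarchical product $W(U)\sqcap H$ is the graph with vertex set $V(W)\times V(H)$ in which $(x_1,y_1)$ and $(x_2,y_2)$ are adjacent if and only if either ($x_1=x_2\in U$ and $y_1y_2\in E(H)$) or ($y_1=y_2$ and $x_1x_2\in E(W)$). Zero forcing: starting from a set $S$ of filled vertices, repeatedly apply the color change rule: if a filled vertex has exactly one unfilled neighbor, that neighbor becomes filled. $S$ is a zero forcing set if this eventually fills every vertex. The zero forcing number $Z(G)$ is the minimum size of a zero forcing set of $G$. -}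

module Defs where

open import Data.Nat using (ℕ; zero; suc; _+_; _≤_)
open import Data.Fin using (Fin; toℕ)
open import Data.Product using (_×_)
open import Data.Sum using (_⊎_)
open import Data.List using (List)
open import Data.List.Membership.Propositional using (_∈_)
open import Relation.Binary.PropositionalEquality using (_≡_; _≢_)

-- Cycle C_n on vertex set Fin n; paper vertex k (1-based) is the Fin element
-- with toℕ = k - 1.  Edges {k,k+1} (1 ≤ k ≤ n-1) and {n,1}.
CycleAdj : (n : ℕ) → Fin n → Fin n → Set
CycleAdj n a b =
  (suc (toℕ a) ≡ toℕ b) ⊎
  (suc (toℕ b) ≡ toℕ a) ⊎
  ((toℕ a ≡ 0) × (suc (toℕ b) ≡ n)) ⊎
  ((toℕ b ≡ 0) × (suc (toℕ a) ≡ n))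

HProdAdj : {VW VH : Set} → (VW → VW → Set) → (VW → Set) → (VH → VH → Set) →
           VW × VH → VW × VH → Set
HProdAdj {VW} {VH} adjW U adjH (x₁ Data.Product., y₁) (x₂ Data.Product., y₂) =
  ((x₁ ≡ x₂) × U x₁ × adjH y₁ y₂) ⊎ ((y₁ ≡ y₂) × adjW x₁ x₂)

data Filled {V : Set} (adj : V → V → Set) (S : List V) : V → Set where
  initial : ∀ {v} → v ∈ S → Filled adj S v
  force   : ∀ {v} (u : V) → Filled adj S u → adj u v →
            (∀ x → adj u x → x ≢ v → Filled adj S x) → Filled adj S v

IsZeroForcingSet : {V : Set} → (V → V → Set) → List V → Set
IsZeroForcingSet {V} adj S = ∀ (v : V) → Filled adj S v

RootSet3 : (w i : ℕ) → Fin w → Set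
RootSet3 w i x = (i ≤ suc (toℕ x)) × (suc (toℕ x) ≤ i + 2)

-- In 0-based coordinates, with the roots in columns 0, 1, 2 of C_w, start from the whole column 2
-- together with (3,0) and (3,1): h + 2 vertices. Whenever (3,y) is filled, the non-root vertices
-- (3,y), …, (w−1,y) force one after another along row y and reach (0,y), and then (2,y) forces (1,y),
-- so row y is filled. Once rows y−1 and y are filled, the root (1,y) has (1,y+1) as its only unfilled
-- neighbour, and then (2,y+1) forces (3,y+1); hence row y+1 is filled too. Every other position of
-- the three roots is reached by rotating C_w, a graph automorphism, and zero forcing sets are carried
-- along graph isomorphisms.

module Submission where

open import Defs
open import Data.Nat using (ℕ; zero; suc; _+_; _∸_; _≤_; _<_; z≤n; s≤s; s≤s⁻¹; _≟_)
open import Data.Nat.Properties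
  using (suc-injective; +-comm; ≤-reflexive; ≤-trans; n≤1+n; m≤n+m; m∸n+n≡m; <⇒≢; <⇒≱; m<1+n⇒m<n∨m≡n)
open import Data.Fin using (Fin; toℕ; fromℕ; inject₁; lower₁) renaming (zero to fzero; suc to fsuc)
open import Data.Fin.Properties
  using (toℕ-injective; toℕ<n; toℕ-fromℕ; toℕ-inject₁; toℕ-inject₁-≢; toℕ-lower₁; inject₁-lower₁; lower₁-inject₁′)
open import Data.Product using (Σ; _×_; _,_; proj₁; proj₂; map₁)
import Data.Product as Product
open import Data.Sum using (_⊎_; inj₁; inj₂; [_,_]′)
open import Data.Empty using (⊥-elim)
open import Function using (id; _∘_; case_of_)
open import Function.Bundles using (_↔_; Inverse; mk↔ₛ′)
open import Relation.Nullary using (¬_; yes; no; contradiction)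
open import Relation.Binary.PropositionalEquality using (_≡_; refl; sym; trans; cong; subst)
open import Data.List using (List; _∷_; length; map; tabulate)
open import Data.List.Properties using (length-map; length-tabulate)
open import Data.List.Membership.Propositional.Properties using (∈-map⁺; ∈-tabulate⁺)
open import Data.List.Relation.Unary.Any using (here; there)

infix 4 Z[_]≤_

Z[_]≤_ : {V : Set} → (V → V → Set) → ℕ → Set
Z[_]≤_ {V} adj k = Σ (List V) λ S → length S ≤ k × IsZeroForcingSet adj S

force′ : {V : Set} {adj : V → V → Set} {S : List V} {u v : V} →
         Filled adj S u → adj u v → (∀ x → adj u x → x ≡ v ⊎ Filled adj S x) → Filled adj S v
force′ {u = u} fu uv others =
  force u fu uv λ x ux x≢v → [ (λ x≡v → contradiction x≡v x≢v) , id ]′ (others x ux)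

record _≅_ {V V′ : Set} (adj : V → V → Set) (adj′ : V′ → V′ → Set) : Set where
  field
    bijection : V ↔ V′
  open Inverse bijection public using (to; from; strictlyInverseˡ; strictlyInverseʳ)
  field
    preserves : ∀ {u v} → adj u v → adj′ (to u) (to v)
    reflects  : ∀ {u v} → adj′ (to u) (to v) → adj u v

  to-injective : ∀ {x y} → to x ≡ to y → x ≡ y
  to-injective {x} {y} e = trans (sym (strictlyInverseʳ x)) (trans (cong from e) (strictlyInverseʳ y))

module _ {V V′ : Set} {adj : V → V → Set} {adj′ : V′ → V′ → Set} (iso : adj ≅ adj′) where
  open _≅_ iso

  Filled-≅ : ∀ {S v} → Filled adj S v → Filled adj′ (map to S) (to v)
  Filled-≅ (initial v∈S) = initial (∈-map⁺ to v∈S)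
  Filled-≅ {S} (force u fu uv others) = force (to u) (Filled-≅ fu) (preserves uv) λ x ux x≢v →
    subst (Filled adj′ (map to S)) (strictlyInverseˡ x)
      (Filled-≅ (others (from x)
        (reflects (subst (adj′ (to u)) (sym (strictlyInverseˡ x)) ux))
        (λ x≡v → x≢v (trans (sym (strictlyInverseˡ x)) (cong to x≡v)))))

  Z≤-≅ : ∀ {k} → Z[ adj ]≤ k → Z[ adj′ ]≤ k
  Z≤-≅ (S , |S|≤k , S-forces) =
    map to S ,
    subst (_≤ _) (sym (length-map to S)) |S|≤k ,
    λ v → subst (Filled adj′ (map to S)) (strictlyInverseˡ v) (Filled-≅ (S-forces (from v)))

CycleAdj-sym : ∀ {n a b} → CycleAdj n a b → CycleAdj n b a
CycleAdj-sym (inj₁ a+1≡b)                  = inj₂ (inj₁ a+1≡b)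
CycleAdj-sym (inj₂ (inj₁ b+1≡a))           = inj₁ b+1≡a
CycleAdj-sym (inj₂ (inj₂ (inj₁ wrap)))     = inj₂ (inj₂ (inj₂ wrap))
CycleAdj-sym (inj₂ (inj₂ (inj₂ wrap)))     = inj₂ (inj₂ (inj₁ wrap))

module _ {k : ℕ} where

  next : Fin (suc k) → Fin (suc k)
  next x with k ≟ toℕ x
  ... | yes _   = fzero
  ... | no k≢x  = fsuc (lower₁ x k≢x)

  prev : Fin (suc k) → Fin (suc k)
  prev fzero    = fromℕ k
  prev (fsuc x) = inject₁ x

  prev-next : ∀ x → prev (next x) ≡ x
  prev-next x with k ≟ toℕ x
  ... | yes k≡x = toℕ-injective (trans (toℕ-fromℕ k) k≡x)
  ... | no k≢x  = inject₁-lower₁ x k≢x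

  next-prev : ∀ x → next (prev x) ≡ x
  next-prev fzero with k ≟ toℕ (fromℕ k)
  ... | yes _   = refl
  ... | no k≢k  = contradiction (sym (toℕ-fromℕ k)) k≢k
  next-prev (fsuc x) with k ≟ toℕ (inject₁ x)
  ... | yes k≡x = contradiction k≡x (toℕ-inject₁-≢ x)
  ... | no k≢x  = cong fsuc (lower₁-inject₁′ x k≢x)

  next-injective : ∀ {x y} → next x ≡ next y → x ≡ y
  next-injective {x} {y} e = trans (sym (prev-next x)) (trans (cong prev e) (prev-next y))

  toℕ-next : ∀ {x} → toℕ x < k → toℕ (next x) ≡ suc (toℕ x)
  toℕ-next {x} x<k with k ≟ toℕ x
  ... | yes k≡x = contradiction (sym k≡x) (<⇒≢ x<k)
  ... | no k≢x  = cong suc (toℕ-lower₁ x k≢x)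

  next-last : ∀ {x} → toℕ x ≡ k → next x ≡ fzero
  next-last {x} x≡k with k ≟ toℕ x
  ... | yes _   = refl
  ... | no k≢x  = contradiction (sym x≡k) k≢x

  CycleAdj-next : ∀ x → CycleAdj (suc k) x (next x)
  CycleAdj-next x with k ≟ toℕ x
  ... | yes k≡x = inj₂ (inj₂ (inj₂ (refl , cong suc (sym k≡x))))
  ... | no k≢x  = inj₁ (sym (cong suc (toℕ-lower₁ x k≢x)))

  CycleAdj-prev : ∀ x → CycleAdj (suc k) x (prev x)
  CycleAdj-prev x = subst (λ z → CycleAdj (suc k) z (prev x)) (next-prev x) (CycleAdj-sym (CycleAdj-next (prev x)))

  next-of-suc : ∀ {a b} → suc (toℕ a) ≡ toℕ b → b ≡ next a
  next-of-suc {a} {b} a+1≡b = toℕ-injective (trans (sym a+1≡b) (sym (toℕ-next a<k)))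
    where
      a<k : toℕ a < k
      a<k = s≤s⁻¹ (subst (_< suc k) (sym a+1≡b) (toℕ<n b))

  next-of-last : ∀ {a b} → toℕ b ≡ 0 → suc (toℕ a) ≡ suc k → b ≡ next a
  next-of-last b≡0 a+1≡n = trans (toℕ-injective b≡0) (sym (next-last (suc-injective a+1≡n)))

  CycleAdj⇒next : ∀ {a b} → CycleAdj (suc k) a b → b ≡ next a ⊎ a ≡ next b
  CycleAdj⇒next (inj₁ a+1≡b)                       = inj₁ (next-of-suc a+1≡b)
  CycleAdj⇒next (inj₂ (inj₁ b+1≡a))                = inj₂ (next-of-suc b+1≡a)
  CycleAdj⇒next (inj₂ (inj₂ (inj₁ (a≡0 , b+1≡n)))) = inj₂ (next-of-last a≡0 b+1≡n)
  CycleAdj⇒next (inj₂ (inj₂ (inj₂ (b≡0 , a+1≡n)))) = inj₁ (next-of-last b≡0 a+1≡n)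

  CycleAdj-neighbour : ∀ {a b} → CycleAdj (suc k) a b → b ≡ next a ⊎ b ≡ prev a
  CycleAdj-neighbour ab with CycleAdj⇒next ab
  ... | inj₁ b≡next-a = inj₁ b≡next-a
  ... | inj₂ refl     = inj₂ (sym (prev-next _))

  rotation : CycleAdj (suc k) ≅ CycleAdj (suc k)
  rotation = record
    { bijection = mk↔ₛ′ next prev next-prev prev-next
    ; preserves = preserves
    ; reflects  = reflects
    }
    where
      preserves : ∀ {a b} → CycleAdj (suc k) a b → CycleAdj (suc k) (next a) (next b)
      preserves ab with CycleAdj⇒next ab
      ... | inj₁ refl = CycleAdj-next (next _)
      ... | inj₂ refl = CycleAdj-sym (CycleAdj-next (next _))

      reflects : ∀ {a b} → CycleAdj (suc k) (next a) (next b) → CycleAdj (suc k) a b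
      reflects {a} {b} ab with CycleAdj⇒next ab
      ... | inj₁ e = subst (CycleAdj (suc k) a) (sym (next-injective e)) (CycleAdj-next a)
      ... | inj₂ e = subst (λ z → CycleAdj (suc k) z b) (sym (next-injective e)) (CycleAdj-sym (CycleAdj-next b))

  cycle-sweep : (P : Fin (suc k) → Set) (a : Fin (suc k)) → P a → P (next a) →
                (∀ x → toℕ a < toℕ x → P (prev x) → P x → P (next x)) →
                ∀ x → toℕ a ≤ toℕ x → P x × P (next x)
  cycle-sweep P a Pa Pa+1 step x a≤x = go (toℕ x ∸ toℕ a) x (sym (m∸n+n≡m a≤x))
    where
      go : ∀ d x → toℕ x ≡ d + toℕ a → P x × P (next x)
      go zero     x        x≡a   with refl ← toℕ-injective {i = x} {j = a} x≡a = Pa , Pa+1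
      go (suc d)  (fsuc x) x≡d+a = P[x+1] , step (fsuc x) a<x+1 (proj₁ ih) P[x+1]
        where
          ih : P (inject₁ x) × P (next (inject₁ x))
          ih = go d (inject₁ x) (trans (toℕ-inject₁ x) (suc-injective x≡d+a))
          P[x+1] : P (fsuc x)
          P[x+1] = subst P (next-prev (fsuc x)) (proj₂ ih)
          a<x+1 : toℕ a < suc (toℕ x)
          a<x+1 = s≤s (subst (toℕ a ≤_) (sym (suc-injective x≡d+a)) (m≤n+m (toℕ a) d))

module _ {VW VW′ VH : Set} {adjW : VW → VW → Set} {adjW′ : VW′ → VW′ → Set} {adjH : VH → VH → Set}
         (σ : adjW ≅ adjW′) where
  open _≅_ σ

  HProdAdj-≅ : {U : VW → Set} {U′ : VW′ → Set} →
               (∀ {x} → U x → U′ (to x)) → (∀ {x} → U′ (to x) → U x) →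
               HProdAdj adjW U adjH ≅ HProdAdj adjW′ U′ adjH
  HProdAdj-≅ U⇒U′ U′⇒U = record
    { bijection = mk↔ₛ′ (map₁ to) (map₁ from)
                        (λ (x , y) → cong (_, y) (strictlyInverseˡ x))
                        (λ (x , y) → cong (_, y) (strictlyInverseʳ x))
    ; preserves = λ where
        (inj₁ (refl , Ux , yy′)) → inj₁ (refl , U⇒U′ Ux , yy′)
        (inj₂ (refl , xx′))      → inj₂ (refl , preserves xx′)
    ; reflects  = λ where
        (inj₁ (e , U′x , yy′)) → inj₁ (to-injective e , U′⇒U U′x , yy′)
        (inj₂ (refl , xx′))    → inj₂ (refl , reflects xx′)
    }

module _ {k : ℕ} (i : ℕ) {x : Fin (suc k)} where

  RootSet3-next : 3 + i ≤ suc k → RootSet3 (suc k) i x → RootSet3 (suc k) (suc i) (next x)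
  RootSet3-next 3+i≤n (i≤x+1 , x+1≤i+2) =
    subst (λ t → suc i ≤ suc t × suc t ≤ suc i + 2) (sym (toℕ-next x<k)) (s≤s i≤x+1 , s≤s x+1≤i+2)
    where
      x<k : toℕ x < k
      x<k = ≤-trans x+1≤i+2 (s≤s⁻¹ (subst (_≤ suc k) (cong suc (+-comm 2 i)) 3+i≤n))

  RootSet3-next⁻¹ : 1 ≤ i → RootSet3 (suc k) (suc i) (next x) → RootSet3 (suc k) i x
  RootSet3-next⁻¹ 1≤i (i+1≤x′+1 , x′+1≤i+3) with m<1+n⇒m<n∨m≡n (toℕ<n x)
  ... | inj₁ x<k rewrite toℕ-next x<k = s≤s⁻¹ i+1≤x′+1 , s≤s⁻¹ x′+1≤i+3
  ... | inj₂ x≡k rewrite next-last x≡k = contradiction (s≤s⁻¹ i+1≤x′+1) (<⇒≱ 1≤i)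

module CycleProduct {k l : ℕ} (U : Fin (suc k) → Set) (S : List (Fin (suc k) × Fin (suc l))) where

  G : Fin (suc k) × Fin (suc l) → Fin (suc k) × Fin (suc l) → Set
  G = HProdAdj (CycleAdj (suc k)) U (CycleAdj (suc l))

  F : Fin (suc k) × Fin (suc l) → Set
  F = Filled G S

  neighbour : ∀ {x y v} → G (x , y) v →
              v ≡ (next x , y) ⊎ v ≡ (prev x , y) ⊎ U x × (v ≡ (x , next y) ⊎ v ≡ (x , prev y))
  neighbour (inj₁ (refl , Ux , yy′)) with CycleAdj-neighbour yy′
  ... | inj₁ refl = inj₂ (inj₂ (Ux , inj₁ refl))
  ... | inj₂ refl = inj₂ (inj₂ (Ux , inj₂ refl))
  neighbour (inj₂ (refl , xx′)) with CycleAdj-neighbour xx′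
  ... | inj₁ refl = inj₁ refl
  ... | inj₂ refl = inj₂ (inj₁ refl)

  FilledUnless : Fin (suc k) × Fin (suc l) → Fin (suc k) × Fin (suc l) → Set
  FilledUnless v w = w ≡ v ⊎ F w

  forceFrom : ∀ {x y v} → F (x , y) → G (x , y) v →
              FilledUnless v (next x , y) → FilledUnless v (prev x , y) →
              (U x → FilledUnless v (x , next y) × FilledUnless v (x , prev y)) → F v
  forceFrom fxy xy~v east west vertical = force′ fxy xy~v λ w xy~w → case neighbour xy~w of λ where
    (inj₁ refl)                   → east
    (inj₂ (inj₁ refl))            → west
    (inj₂ (inj₂ (Ux , inj₁ refl))) → proj₁ (vertical Ux)
    (inj₂ (inj₂ (Ux , inj₂ refl))) → proj₂ (vertical Ux)

  forceEast : ∀ {x y} → F (x , y) → F (prev x , y) → (U x → F (x , next y) × F (x , prev y)) →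
              F (next x , y)
  forceEast {x} fxy west vertical =
    forceFrom fxy (inj₂ (refl , CycleAdj-next x)) (inj₁ refl) (inj₂ west) (Product.map inj₂ inj₂ ∘ vertical)

  forceWest : ∀ {x y} → F (x , y) → F (next x , y) → (U x → F (x , next y) × F (x , prev y)) →
              F (prev x , y)
  forceWest {x} fxy east vertical =
    forceFrom fxy (inj₂ (refl , CycleAdj-prev x)) (inj₂ east) (inj₁ refl) (Product.map inj₂ inj₂ ∘ vertical)

  forceNorth : ∀ {x y} → U x → F (x , y) → F (next x , y) → F (prev x , y) → F (x , prev y) →
               F (x , next y)
  forceNorth {y = y} Ux fxy east west south =
    forceFrom fxy (inj₁ (refl , Ux , CycleAdj-next y)) (inj₂ east) (inj₂ west) (λ _ → inj₁ refl , inj₂ south)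

module FirstRoots (m n : ℕ) where

  W H : ℕ
  W = 4 + m
  H = 2 + n

  one two three : Fin W
  one   = fsuc fzero
  two   = fsuc (fsuc fzero)
  three = fsuc (fsuc (fsuc fzero))

  seed : List (Fin W × Fin H)
  seed = (three , fzero) ∷ (three , fsuc fzero) ∷ tabulate (two ,_)

  open CycleProduct (RootSet3 W 1) seed using (G; F; forceEast; forceWest; forceNorth)

  Row : Fin H → Set
  Row y = ∀ x → F (x , y)

  column-two : ∀ y → F (two , y)
  column-two y = initial (there (there (∈-tabulate⁺ {f = two ,_} y)))

  beyond-roots : ∀ {x} → 2 < toℕ x → ¬ RootSet3 W 1 x
  beyond-roots 2<x (_ , x<3) = <⇒≱ 2<x (s≤s⁻¹ x<3)

  sweep-east : ∀ {y} → F (three , y) → ∀ x → 2 ≤ toℕ x → F (x , y) × F (next x , y)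
  sweep-east {y} f3 = cycle-sweep (λ x → F (x , y)) two (column-two y) f3
    λ x 2<x west fx → forceEast fx west (⊥-elim ∘ beyond-roots 2<x)

  row-from-three : ∀ {y} → F (three , y) → Row y
  row-from-three {y} f3 fzero =
    subst (λ x → F (x , y)) (next-prev fzero) (proj₂ (sweep-east f3 (prev fzero) (s≤s (s≤s z≤n))))
  row-from-three {y} f3 (fsuc fzero) =
    forceWest (column-two y) f3 (λ _ → column-two (next y) , column-two (prev y))
  row-from-three {y} f3 x@(fsuc (fsuc _)) = proj₁ (sweep-east f3 x (s≤s (s≤s z≤n)))

  row-from-one : ∀ {y} → F (one , y) → Row y
  row-from-one {y} f1 =
    row-from-three (forceEast (column-two y) f1 (λ _ → column-two (next y) , column-two (prev y)))

  rows : ∀ y → Row y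
  rows y = proj₁ (cycle-sweep Row fzero (row-from-three (initial (here refl)))
                                       (row-from-three (initial (there (here refl))))
                                       next-row y z≤n)
    where
      next-row : ∀ y → 0 < toℕ y → Row (prev y) → Row y → Row (next y)
      next-row _ _ below row = row-from-one
        (forceNorth (s≤s z≤n , s≤s (s≤s z≤n)) (row one) (row two) (row fzero) (below one))

  Z≤ : Z[ G ]≤ H + 2
  Z≤ = seed ,
       ≤-reflexive (trans (cong (2 +_) (length-tabulate (two ,_))) (+-comm 2 H)) ,
       λ (x , y) → rows y x

module _ (m n : ℕ) where

  Z≤-RootSet3 : ∀ j → 3 + j ≤ 4 + m →
                 Z[ HProdAdj (CycleAdj (4 + m)) (RootSet3 (4 + m) (suc j)) (CycleAdj (2 + n)) ]≤ (2 + n) + 2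
  Z≤-RootSet3 zero    _     = FirstRoots.Z≤ m n
  Z≤-RootSet3 (suc j) 4+j≤w =
    Z≤-≅ (HProdAdj-≅ rotation (RootSet3-next (suc j) 4+j≤w) (RootSet3-next⁻¹ (suc j) (s≤s z≤n)))
         (Z≤-RootSet3 j (≤-trans (n≤1+n _) 4+j≤w))

mainTheorem5 : (w h i : ℕ) → 4 ≤ w → 4 ≤ h → 1 ≤ i → i ≤ w ∸ 2 →
    Σ (List (Fin w × Fin h)) (λ S →
      (length S ≤ h + 2) ×
      IsZeroForcingSet (HProdAdj (CycleAdj w) (RootSet3 w i) (CycleAdj h)) S)
mainTheorem5 (suc (suc (suc (suc m)))) (suc (suc (suc (suc n)))) (suc j)
             (s≤s (s≤s (s≤s (s≤s z≤n)))) (s≤s (s≤s (s≤s (s≤s z≤n)))) (s≤s z≤n) i≤w-2 =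
  Z≤-RootSet3 m (2 + n) j (s≤s (s≤s i≤w-2))
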